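{- Let $k \geq 0$ and let $G$ be a cubic graph with $\mu_3(G) = k$. If $\mathrm{girth}(G) \geq k$, then every $k$-core of $G$ is bipartite. If $\mathrm{girth}(G) > k$, then every $k$-core of $G$ is cyclic.
   Context: Graphs are finite, may have parallel edges, but no loops. A 1-factor is a spanning 1-regular subgraph, identified with its edge set. For a cubic graph $G$ with a 1-factor, $\mu_3(G) = |E(G)| - \max\{|M_1\cup M_2\cup M_3| : M_i \text{ 1-factors of } G\}$. For $X\subseteq E(G)$, $G[X]$ is the graph with edge set $X$ and vertex set all endpoints of edges of $X$. For three pairwise different 1-factors $M_1,M_2,M_3$ of $G$, let $\mathcal{M} = \bigcup_{i\neq j}(M_i\cap M_j)$ and $\mathcal{U} = E(G) - (M_1\cup M_2\cup M_3)$; if $|\mathcal{U}|=k$, then $G[\mathcal{M}\cup\mathcal{U}]$ is the $k$-core of $G$ with respect to $M_1,M_2,M_3$. A core is cyclic if it is a cycle, i.e. all its vertices have even degree (equivalently it is 2-regular); a core with respect to $M_1,M_2,M_3$ is cyclic iff $M_1\cap M_2\cap M_3=\emptyset$. The girth is the length of a shortest circuit (two parallel edges form a circuit of length 2). -}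

module Defs where

open import Data.Nat using (ℕ; zero; suc; _+_; _≤_; _<_)
open import Data.Nat.Divisibility using (_∣_)
open import Data.Bool using (Bool; true; _∨_)
open import Data.Fin using (Fin; toℕ; _≟_)
open import Data.Fin.Subset using (Subset; _∪_; _∩_; ∁; ∣_∣; _∈_)
open import Data.Vec using (tabulate)
open import Data.Product using (Σ; ∃; _×_; _,_)
open import Data.Sum using (_⊎_)
open import Function.Definitions using (Injective)
open import Relation.Nullary using (¬_; does)
open import Relation.Binary.PropositionalEquality using (_≡_; _≢_)

-- A finite multigraph without loops: vertices Fin n, edges Fin m,
-- edge e joins src e and tgt e (parallel edges allowed, loops forbidden).
record Graph : Set where
  field
    n      : ℕ
    m      : ℕ
    src    : Fin m → Fin n
    tgt    : Fin m → Fin n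
    noLoop : ∀ e → src e ≢ tgt e
open Graph public

EdgeSet : Graph → Set
EdgeSet G = Subset (m G)

incident : (G : Graph) → Fin (n G) → EdgeSet G
incident G v = tabulate (λ e → does (src G e ≟ v) ∨ does (tgt G e ≟ v))

-- degree of v in the graph G[X] (no loops, so this is the usual degree)
deg : (G : Graph) → EdgeSet G → Fin (n G) → ℕ
deg G X v = ∣ X ∩ incident G v ∣

allEdges : (G : Graph) → EdgeSet G
allEdges G = tabulate (λ _ → true)

Cubic : Graph → Set
Cubic G = ∀ v → deg G (allEdges G) v ≡ 3

IsOneFactor : (G : Graph) → EdgeSet G → Set
IsOneFactor G M = ∀ v → deg G M v ≡ 1

-- μ₃(G) = k  :  |E(G)| - max |M₁ ∪ M₂ ∪ M₃| = k  (over 1-factors M₁,M₂,M₃)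
Mu3 : Graph → ℕ → Set
Mu3 G k =
  (Σ (EdgeSet G) λ M₁ → Σ (EdgeSet G) λ M₂ → Σ (EdgeSet G) λ M₃ →
     IsOneFactor G M₁ × IsOneFactor G M₂ × IsOneFactor G M₃ ×
     ∣ M₁ ∪ (M₂ ∪ M₃) ∣ + k ≡ m G)
  ×
  (∀ (M₁ M₂ M₃ : EdgeSet G) →
     IsOneFactor G M₁ → IsOneFactor G M₂ → IsOneFactor G M₃ →
     ∣ M₁ ∪ (M₂ ∪ M₃) ∣ + k ≤ m G)

calM : {G : Graph} → EdgeSet G → EdgeSet G → EdgeSet G → EdgeSet G
calM M₁ M₂ M₃ = (M₁ ∩ M₂) ∪ ((M₁ ∩ M₃) ∪ (M₂ ∩ M₃))

calU : {G : Graph} → EdgeSet G → EdgeSet G → EdgeSet G → EdgeSet G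
calU M₁ M₂ M₃ = ∁ (M₁ ∪ (M₂ ∪ M₃))

-- H (an edge set; the core is the graph G[H]) is a k-core of G
IsKCore : (G : Graph) → ℕ → EdgeSet G → Set
IsKCore G k H =
  Σ (EdgeSet G) λ M₁ → Σ (EdgeSet G) λ M₂ → Σ (EdgeSet G) λ M₃ →
    IsOneFactor G M₁ × IsOneFactor G M₂ × IsOneFactor G M₃ ×
    M₁ ≢ M₂ × M₁ ≢ M₃ × M₂ ≢ M₃ ×
    ∣ calU {G} M₁ M₂ M₃ ∣ ≡ k ×
    H ≡ calM {G} M₁ M₂ M₃ ∪ calU {G} M₁ M₂ M₃

IsBipartite : (G : Graph) → EdgeSet G → Set
IsBipartite G H = Σ (Fin (n G) → Bool) λ c → ∀ e → e ∈ H → c (src G e) ≢ c (tgt G e)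

IsCyclic : (G : Graph) → EdgeSet G → Set
IsCyclic G H = ∀ v → 2 ∣ deg G H v

Joins : (G : Graph) → Fin (m G) → Fin (n G) → Fin (n G) → Set
Joins G e u v = (src G e ≡ u × tgt G e ≡ v) ⊎ (src G e ≡ v × tgt G e ≡ u)

Circuit : (G : Graph) → ℕ → Set
Circuit G ℓ =
  2 ≤ ℓ ×
  Σ (Fin ℓ → Fin (n G)) λ vs → Σ (Fin ℓ → Fin (m G)) λ es →
    Injective _≡_ _≡_ vs × Injective _≡_ _≡_ es ×
    (∀ (i j : Fin ℓ) →
       (suc (toℕ i) ≡ toℕ j ⊎ (suc (toℕ i) ≡ ℓ × toℕ j ≡ 0)) →
       Joins G (es i) (vs i) (vs j))

-- girth(G) ≥ k  (vacuous if G has no circuit, girth = ∞)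
GirthAtLeast : Graph → ℕ → Set
GirthAtLeast G k = ∀ ℓ → Circuit G ℓ → k ≤ ℓ

GirthGreater : Graph → ℕ → Set
GirthGreater G k = ∀ ℓ → Circuit G ℓ → k < ℓ

-- Let Z be the edges lying in an even number (0 or 2) of M₁, M₂, M₃ and T those lying in all three,
-- so that the core is Z ∪ T.  Checking the 27 ways three 1-factors can meet a cubic vertex shows
-- that Z has degree 0 or 2 everywhere, and double counting gives |Z| + 2|T| = 2|𝓤| = 2k.  Hence
-- Z is a disjoint union of circuits, along which uncovered edges alternate away from T.
-- If T = ∅ the core is Z: every degree is 0 or 2 and every circuit is even, so it is cyclic and
-- bipartite.  If e = xy ∈ T, the Z-circuit through x either leaves room for a second Z-circuit, of
-- total length at most |Z| ≤ 2k − 2, or contains all of Z and also y, so that e splits it into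
-- two circuits of total length |Z| + 2 ≤ 2k.  Girth above k excludes both; girth at least k forces
-- equality, T = {e}, an even Z-circuit, and an odd distance from x to y along it (its edges alternate
-- between uncovered and doubly covered, and both end edges are uncovered), so the core is again
-- bipartite.

module Submission where

open import Defs
import Data.Bool as Bool
open import Data.Bool using (Bool; true; false; not; _∧_; _∨_; _xor_)
open import Data.Bool.Properties using (not-involutive; xor-same; not-¬; ∨-identityʳ; not-distribʳ-xor)
open import Data.Empty using (⊥-elim)
open import Data.Fin as Fin using (Fin; zero; suc; toℕ)
import Data.Fin.Properties as Finₚ
open import Data.Fin.Properties using (all?; any?; toℕ-injective; toℕ<n; injective⇒≤)
open import Data.Fin.Subset using (_⊆_; ⊤; Subset; _∈_; _∉_; _─_; ∣_∣; _∩_; _∪_; Nonempty)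
open import Data.Fin.Subset.Properties using (x∈p⇒∣p-x∣<∣p∣; x∈p∧x≢y⇒x∈p-y; _∈?_; ∩-identityˡ; nonempty?; x∈p∧x∉q⇒x∈p─q; p─q⊆p; x∈p∩q⁺; p∩q≢∅⇒∣p─q∣<∣p∣)
import Data.Nat as ℕ
open import Data.Nat using (ℕ; zero; suc; _+_; _*_; _∸_; _≤_; _<_; _≤?_; _<?_; z≤n; s≤s; z<s)
open import Data.Nat.Properties
open import Data.Nat.Divisibility using (_∣_; _∣?_)
open import Data.Nat.Induction using (<-rec)
open import Data.Product using (Σ; ∃-syntax; _×_; _,_; proj₁; proj₂)
import Data.Sum
open import Data.Sum using (_⊎_; inj₁; inj₂; [_,_]′)
open import Data.Vec using (here; there; []; _∷_; lookup; tabulate)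
open import Data.Vec.Properties using (lookup-map; tabulate-cong; tabulate∘lookup; lookup-replicate; []=⇒lookup; lookup⇒[]=; lookup∘tabulate; lookup-zipWith)
open import Function using (_∘_; _⇔_; mk⇔; Equivalence)
open import Function.Definitions using (Injective)
open import Relation.Binary.PropositionalEquality using (_≡_; _≢_; refl; sym; trans; cong; cong₂; subst; subst₂; module ≡-Reasoning)
open import Relation.Binary.Definitions using (tri<; tri≈; tri>)
open import Relation.Nullary using (¬_; Dec; yes; no; does)
open import Relation.Nullary.Decidable using (dec-true; from-yes; ¬?; _×-dec_; _⊎-dec_; _→-dec_)

open import Algebra.Properties.Semiring.Sum +-*-semiring using (sum-syntax; ∑-comm; ∑-distrib-+; *-distribˡ-sum; sum-cong-≗; sum-replicate-zero)

indicator : Bool → ℕ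
indicator true  = 1
indicator false = 0

∈-tabulate : ∀ {n} {x : Fin n} {f : Fin n → Bool} → x ∈ tabulate f ⇔ f x ≡ true
∈-tabulate {x = x} {f} = mk⇔ (λ x∈ → trans (sym (lookup∘tabulate f x)) ([]=⇒lookup x∈))
                             (λ fx → lookup⇒[]= x (tabulate f) (trans (lookup∘tabulate f x) fx))

∈-tabulate-does : ∀ {n p} {P : Fin n → Set p} (P? : ∀ x → Dec (P x)) {x} →
  x ∈ tabulate (does ∘ P?) ⇔ P x
∈-tabulate-does {P = P} P? {x} = mk⇔ (to ∘ Equivalence.to ∈-tabulate) (Equivalence.from ∈-tabulate ∘ dec-true (P? x))
  where
  to : does (P? x) ≡ true → P x
  to _ with P? x
  ... | yes Px = Px

x∈p─q⇒x∉q : ∀ {n} {x : Fin n} {p q : Subset n} → x ∈ p ─ q → x ∉ q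
x∈p─q⇒x∉q {p = true  ∷ p} {false ∷ q} here       ()
x∈p─q⇒x∉q {p = _     ∷ p} {_     ∷ q} (there x∈) (there x∈q) = x∈p─q⇒x∉q x∈ x∈q

empty-difference⇒⊆ : ∀ {n} {p q : Subset n} → ¬ Nonempty (p ─ q) → p ⊆ q
empty-difference⇒⊆ {q = q} empty {x} x∈p with x ∈? q
... | yes x∈q = x∈q
... | no x∉q  = ⊥-elim (empty (x , x∈p∧x∉q⇒x∈p─q x∈p x∉q))

x∈p⇒0<∣p∣ : ∀ {n} {x : Fin n} {p : Subset n} → x ∈ p → 0 < ∣ p ∣
x∈p⇒0<∣p∣ x∈p = ≤-<-trans z≤n (x∈p⇒∣p-x∣<∣p∣ x∈p)

∣p∣≤1⇒unique : ∀ {n} {x y : Fin n} {p : Subset n} → ∣ p ∣ ≤ 1 → x ∈ p → y ∈ p → x ≡ y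
∣p∣≤1⇒unique {x = x} {y} {p} ∣p∣≤1 x∈p y∈p with x Fin.≟ y
... | yes x≡y = x≡y
... | no x≢y  = ⊥-elim (<⇒≱ (≤-<-trans (x∈p⇒0<∣p∣ (x∈p∧x≢y⇒x∈p-y y∈p (x≢y ∘ sym))) (x∈p⇒∣p-x∣<∣p∣ x∈p)) ∣p∣≤1)

∣p∣≡∑ : ∀ {n} (p : Subset n) → ∣ p ∣ ≡ ∑[ i < n ] indicator (lookup p i)
∣p∣≡∑ []          = refl
∣p∣≡∑ (true ∷ p)  = cong suc (∣p∣≡∑ p)
∣p∣≡∑ (false ∷ p) = ∣p∣≡∑ p

∣p∣≡∣p∩q∣+∣p─q∣ : ∀ {n} (p q : Subset n) → ∣ p ∣ ≡ ∣ p ∩ q ∣ + ∣ p ─ q ∣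
∣p∣≡∣p∩q∣+∣p─q∣ []          []          = refl
∣p∣≡∣p∩q∣+∣p─q∣ (true ∷ p)  (true ∷ q)  = cong suc (∣p∣≡∣p∩q∣+∣p─q∣ p q)
∣p∣≡∣p∩q∣+∣p─q∣ (true ∷ p)  (false ∷ q) = trans (cong suc (∣p∣≡∣p∩q∣+∣p─q∣ p q)) (sym (+-suc _ _))
∣p∣≡∣p∩q∣+∣p─q∣ (false ∷ p) (true ∷ q)  = ∣p∣≡∣p∩q∣+∣p─q∣ p q
∣p∣≡∣p∩q∣+∣p─q∣ (false ∷ p) (false ∷ q) = ∣p∣≡∣p∩q∣+∣p─q∣ p q

record Enumeration {n} (S : Subset n) (k : ℕ) : Set where
  field
    elem           : Fin k → Fin n
    elem-injective : Injective _≡_ _≡_ elem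
    elem-∈         : ∀ q → elem q ∈ S
    ∈⇒elem         : ∀ {x} → x ∈ S → ∃[ q ] elem q ≡ x
    ∣∩∣≡∑          : ∀ X → ∣ X ∩ S ∣ ≡ ∑[ q < k ] indicator (lookup X (elem q))

enumerate : ∀ {n} (S : Subset n) → Enumeration S ∣ S ∣
enumerate [] = record
  { elem = λ () ; elem-injective = λ {} ; elem-∈ = λ () ; ∈⇒elem = λ () ; ∣∩∣≡∑ = λ { [] → refl } }
enumerate (false ∷ S) = record
  { elem = suc ∘ elem
  ; elem-injective = elem-injective ∘ Finₚ.suc-injective
  ; elem-∈ = there ∘ elem-∈
  ; ∈⇒elem = λ { (there x∈S) → let q , eq = ∈⇒elem x∈S in q , cong suc eq }
  ; ∣∩∣≡∑ = λ { (true ∷ X) → ∣∩∣≡∑ X ; (false ∷ X) → ∣∩∣≡∑ X } }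
  where open Enumeration (enumerate S)
enumerate {suc n} (true ∷ S) = record
  { elem = elem′
  ; elem-injective = injective
  ; elem-∈ = λ { zero → here ; (suc q) → there (elem-∈ q) }
  ; ∈⇒elem = λ { here → zero , refl
               ; (there x∈S) → let q , eq = ∈⇒elem x∈S in suc q , cong suc eq }
  ; ∣∩∣≡∑ = λ { (true ∷ X) → cong suc (∣∩∣≡∑ X) ; (false ∷ X) → ∣∩∣≡∑ X } }
  where
  open Enumeration (enumerate S)
  elem′ : Fin (suc ∣ S ∣) → Fin (suc n)
  elem′ zero    = zero
  elem′ (suc q) = suc (elem q)
  injective : Injective _≡_ _≡_ elem′
  injective {zero}  {zero}  _  = refl
  injective {suc q} {suc r} eq = cong suc (elem-injective (Finₚ.suc-injective eq))
  injective {zero}  {suc r} ()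
  injective {suc q} {zero}  ()

members-≤-∣∣ : ∀ {n L} (S : Subset n) (g : Fin L → Fin n) →
  Injective _≡_ _≡_ g → (∀ i → g i ∈ S) → L ≤ ∣ S ∣
members-≤-∣∣ S g g-injective g∈S = injective⇒≤ position-injective
  where
  open Enumeration (enumerate S)
  position : ∀ i → ∃[ q ] elem q ≡ g i
  position i = ∈⇒elem (g∈S i)
  position-injective : Injective _≡_ _≡_ (proj₁ ∘ position)
  position-injective {i} {j} eq = g-injective (begin
    g i                    ≡⟨ proj₂ (position i) ⟨
    elem (proj₁ (position i)) ≡⟨ cong elem eq ⟩
    elem (proj₁ (position j)) ≡⟨ proj₂ (position j) ⟩
    g j                    ∎)
    where open ≡-Reasoning

least : ∀ {p} {P : ℕ → Set p} → (∀ i → Dec (P i)) →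
  ∀ {j} → P j → ∃[ i ] P i × (∀ {i′} → i′ < i → ¬ P i′)
least {P = P} P? {j} = <-rec Goal search j
  where
  Goal : ℕ → Set _
  Goal j = P j → ∃[ i ] P i × (∀ {i′} → i′ < i → ¬ P i′)
  search : ∀ j → (∀ {i} → i < j → Goal i) → Goal j
  search j below Pj with anyUpTo? P? j
  ... | yes (i , i<j , Pi) = below i<j Pi
  ... | no none            = j , Pj , λ i<j Pi → none (_ , i<j , Pi)

oddᵇ : ℕ → Bool
oddᵇ zero    = false
oddᵇ (suc n) = not (oddᵇ n)

oddᵇ-+2 : ∀ n → oddᵇ (suc (suc n)) ≡ oddᵇ n
oddᵇ-+2 n = not-involutive (oddᵇ n)

oddᵇ-double : ∀ n → oddᵇ (n + n) ≡ false
oddᵇ-double zero    = refl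
oddᵇ-double (suc n) = trans (cong (oddᵇ ∘ suc) (+-suc n n)) (trans (oddᵇ-+2 (n + n)) (oddᵇ-double n))

alternating⇒oddᵇ : ∀ (f : ℕ → Bool) {l} → (∀ {a} → a < l → f (suc a) ≡ not (f a)) →
  oddᵇ l ≡ f 0 xor f l
alternating⇒oddᵇ f {zero}  alt = sym (xor-same (f 0))
alternating⇒oddᵇ f {suc l} alt = begin
  not (oddᵇ l)          ≡⟨ cong not (alternating⇒oddᵇ f (alt ∘ m≤n⇒m≤1+n)) ⟩
  not (f 0 xor f l)     ≡⟨ not-distribʳ-xor (f 0) (f l) ⟩
  f 0 xor not (f l)     ≡⟨ cong (f 0 xor_) (alt ≤-refl) ⟨
  f 0 xor f (suc l)     ∎
  where open ≡-Reasoning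

∑-indicator-≟ : ∀ {n} (a : Fin n) → ∑[ v < n ] indicator (does (a Fin.≟ v)) ≡ 1
∑-indicator-≟ {suc n} zero    = cong suc (sum-replicate-zero n)
∑-indicator-≟ {suc n} (suc a) = ∑-indicator-≟ a

∑-indicator-≟-pair : ∀ {n} {a b : Fin n} → a ≢ b →
  ∑[ v < n ] indicator (does (a Fin.≟ v) ∨ does (b Fin.≟ v)) ≡ 2
∑-indicator-≟-pair {suc n} {zero}  {zero}  a≢b = ⊥-elim (a≢b refl)
∑-indicator-≟-pair {suc n} {zero}  {suc b} _   = cong suc (∑-indicator-≟ b)
∑-indicator-≟-pair {suc n} {suc a} {zero}  _   =
  cong suc (trans (sum-cong-≗ {n} λ v → cong indicator (∨-identityʳ _)) (∑-indicator-≟ a))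
∑-indicator-≟-pair {suc n} {suc a} {suc b} a≢b = ∑-indicator-≟-pair (a≢b ∘ cong suc)

-- Incidence and the handshake lemma
module GraphBasics (G : Graph) where

  V E : Set
  V = Fin (n G)
  E = Fin (m G)

  Inc : V → E → Set
  Inc v e = e ∈ incident G v

  Inc⇔endpoint : ∀ {v e} → Inc v e ⇔ (src G e ≡ v ⊎ tgt G e ≡ v)
  Inc⇔endpoint {v} {e} = mk⇔ (to ∘ Equivalence.to ∈-tabulate) (Equivalence.from ∈-tabulate ∘ from)
    where
    to : does (src G e Fin.≟ v) ∨ does (tgt G e Fin.≟ v) ≡ true → src G e ≡ v ⊎ tgt G e ≡ v
    to _ with src G e Fin.≟ v | tgt G e Fin.≟ v
    ... | yes s≡v | _       = inj₁ s≡v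
    ... | no _    | yes t≡v = inj₂ t≡v
    from : src G e ≡ v ⊎ tgt G e ≡ v → does (src G e Fin.≟ v) ∨ does (tgt G e Fin.≟ v) ≡ true
    from _ with src G e Fin.≟ v | tgt G e Fin.≟ v
    from _          | yes _  | _      = refl
    from _          | no _   | yes _  = refl
    from (inj₁ s≡v) | no s≢v | no _   = ⊥-elim (s≢v s≡v)
    from (inj₂ t≡v) | no _   | no t≢v = ⊥-elim (t≢v t≡v)

  src-joins-tgt : ∀ {e} → Joins G e (src G e) (tgt G e)
  src-joins-tgt = inj₁ (refl , refl)

  joins-sym : ∀ {e u v} → Joins G e u v → Joins G e v u
  joins-sym (inj₁ p) = inj₂ p
  joins-sym (inj₂ p) = inj₁ p

  joins⇒≢ : ∀ {e u v} → Joins G e u v → u ≢ v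
  joins⇒≢ {e} (inj₁ (refl , refl)) = noLoop G e
  joins⇒≢ {e} (inj₂ (refl , refl)) = noLoop G e ∘ sym

  joins⇒Incˡ : ∀ {e u v} → Joins G e u v → Inc u e
  joins⇒Incˡ (inj₁ (s≡u , _)) = Equivalence.from Inc⇔endpoint (inj₁ s≡u)
  joins⇒Incˡ (inj₂ (_ , t≡u)) = Equivalence.from Inc⇔endpoint (inj₂ t≡u)

  joins⇒Incʳ : ∀ {e u v} → Joins G e u v → Inc v e
  joins⇒Incʳ = joins⇒Incˡ ∘ joins-sym

  Inc⇒joins : ∀ {w e} → Inc w e → ∃[ u ] Joins G e w u
  Inc⇒joins {e = e} w∈ with Equivalence.to Inc⇔endpoint w∈
  ... | inj₁ s≡w = tgt G e , inj₁ (s≡w , refl)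
  ... | inj₂ t≡w = src G e , inj₂ (refl , t≡w)

  joins-endpoint : ∀ {e u v w} → Joins G e u v → Inc w e → w ≡ u ⊎ w ≡ v
  joins-endpoint (inj₁ (refl , refl)) w∈ = [ inj₁ ∘ sym , inj₂ ∘ sym ]′ (Equivalence.to Inc⇔endpoint w∈)
  joins-endpoint (inj₂ (refl , refl)) w∈ = [ inj₂ ∘ sym , inj₁ ∘ sym ]′ (Equivalence.to Inc⇔endpoint w∈)

  joins-unique : ∀ {e u v u′ v′} → Joins G e u v → Joins G e u′ v′ →
    (u ≡ u′ × v ≡ v′) ⊎ (u ≡ v′ × v ≡ u′)
  joins-unique (inj₁ (refl , refl)) (inj₁ (refl , refl)) = inj₁ (refl , refl)
  joins-unique (inj₁ (refl , refl)) (inj₂ (refl , refl)) = inj₂ (refl , refl)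
  joins-unique (inj₂ (refl , refl)) (inj₁ (refl , refl)) = inj₂ (refl , refl)
  joins-unique (inj₂ (refl , refl)) (inj₂ (refl , refl)) = inj₁ (refl , refl)

  joins-proper : ∀ {e u v} {c : V → Bool} → Joins G e u v → c u ≢ c v → c (src G e) ≢ c (tgt G e)
  joins-proper (inj₁ (refl , refl)) cu≢cv = cu≢cv
  joins-proper (inj₂ (refl , refl)) cu≢cv = cu≢cv ∘ sym

  joins-determined : ∀ {e u v v′} → Joins G e u v → Joins G e u v′ → v ≡ v′
  joins-determined j j′ with joins-unique j j′
  ... | inj₁ (_ , v≡v′)   = v≡v′
  ... | inj₂ (u≡v′ , v≡u) = ⊥-elim (joins⇒≢ j (sym v≡u))

  incidence : V → E → ℕ
  incidence v e = indicator (lookup (incident G v) e)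

  deg≡∑ : ∀ X v → deg G X v ≡ ∑[ e < m G ] (indicator (lookup X e) * incidence v e)
  deg≡∑ X v = trans (∣p∣≡∑ (X ∩ incident G v)) (sum-cong-≗ {m G} λ e →
    trans (cong indicator (lookup-zipWith _∧_ e X (incident G v)))
          (indicator-∧ (lookup X e) (lookup (incident G v) e)))
    where
    indicator-∧ : ∀ x y → indicator (x ∧ y) ≡ indicator x * indicator y
    indicator-∧ true  y = sym (+-identityʳ _)
    indicator-∧ false y = refl

  ∑-incidence : ∀ e → ∑[ v < n G ] incidence v e ≡ 2
  ∑-incidence e = trans (sum-cong-≗ {n G} λ v → cong indicator (lookup∘tabulate _ e)) (∑-indicator-≟-pair (noLoop G e))

  handshake : ∀ X → ∑[ v < n G ] deg G X v ≡ 2 * ∣ X ∣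
  handshake X = begin
    ∑[ v < n G ] deg G X v                            ≡⟨ sum-cong-≗ {n G} (deg≡∑ X) ⟩
    ∑[ v < n G ] ∑[ e < m G ] (χ e * incidence v e)   ≡⟨ ∑-comm {n G} {m G} _ ⟩
    ∑[ e < m G ] ∑[ v < n G ] (χ e * incidence v e)   ≡⟨ sum-cong-≗ {m G} (λ e → *-distribˡ-sum (χ e) (λ v → incidence v e)) ⟨
    ∑[ e < m G ] (χ e * ∑[ v < n G ] incidence v e)   ≡⟨ sum-cong-≗ {m G} (λ e → trans (cong (χ e *_) (∑-incidence e)) (*-comm (χ e) 2)) ⟩
    ∑[ e < m G ] (2 * χ e)                            ≡⟨ *-distribˡ-sum {m G} 2 χ ⟨
    2 * ∑[ e < m G ] χ e                              ≡⟨ cong (2 *_) (∣p∣≡∑ X) ⟨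
    2 * ∣ X ∣                                         ∎
    where
    open ≡-Reasoning
    χ : E → ℕ
    χ e = indicator (lookup X e)

-- Circuits in edge sets of degree 0 or 2
module Cycles (G : Graph) where
  open GraphBasics G

  record Partner (X : EdgeSet G) (v : V) (f : E) : Set where
    field
      edge     : E
      edge∈X   : edge ∈ X
      Inc-edge : Inc v edge
      edge≢f   : edge ≢ f
      unique   : ∀ {g} → g ∈ X → Inc v g → g ≡ f ⊎ g ≡ edge

  DegreeZeroOrTwo : EdgeSet G → Set
  DegreeZeroOrTwo X = ∀ {v f} → f ∈ X → Inc v f → Partner X v f

  Alternating : (E → Bool) → EdgeSet G → Set
  Alternating label X = ∀ {v f g} → f ∈ X → g ∈ X → Inc v f → Inc v g → f ≢ g → label f ≡ not (label g)

  -- Positions are natural numbers so that walks and arcs re-index by arithmetic; only those below len matter.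
  record Cycle (X : EdgeSet G) : Set where
    field
      len              : ℕ
      vertex           : ℕ → V
      edge             : ℕ → E
      len≥2            : 2 ≤ len
      closed           : vertex len ≡ vertex 0
      vertex-injective : ∀ {i j} → i < len → j < len → vertex i ≡ vertex j → i ≡ j
      edge-injective   : ∀ {i j} → i < len → j < len → edge i ≡ edge j → i ≡ j
      edge-joins       : ∀ {i} → i < len → Joins G (edge i) (vertex i) (vertex (suc i))
      edge∈X           : ∀ {i} → i < len → edge i ∈ X

    0<len : 0 < len
    0<len = <-trans z<s len≥2

    last : ℕ
    last = len ∸ 1

    last+1≡len : suc last ≡ len
    last+1≡len = m+[n∸m]≡n 0<len

    last<len : last < len
    last<len = subst (last <_) last+1≡len ≤-refl

    last≢0 : last ≢ 0
    last≢0 last≡0 = <⇒≱ len≥2 (subst (_≤ 1) last+1≡len (s≤s (≤-reflexive last≡0)))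

    Inc-vertex0-last : Inc (vertex 0) (edge last)
    Inc-vertex0-last = subst (λ w → Inc w (edge last)) (trans (cong vertex last+1≡len) closed)
                             (joins⇒Incʳ (edge-joins last<len))

    occurs? : ∀ e → Dec (∃[ i ] i < len × edge i ≡ e)
    occurs? e = anyUpTo? (λ i → edge i Fin.≟ e) len

    edgeSet : EdgeSet G
    edgeSet = tabulate (does ∘ occurs?)

    ∈edgeSet⇔ : ∀ {e} → e ∈ edgeSet ⇔ (∃[ i ] i < len × edge i ≡ e)
    ∈edgeSet⇔ = ∈-tabulate-does occurs?

    edge∈edgeSet : ∀ {i} → i < len → edge i ∈ edgeSet
    edge∈edgeSet i<len = Equivalence.from ∈edgeSet⇔ (_ , i<len , refl)

    toCircuit : Circuit G len
    toCircuit = len≥2 , vertex ∘ toℕ , edge ∘ toℕ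
      , (λ eq → toℕ-injective (vertex-injective (toℕ<n _) (toℕ<n _) eq))
      , (λ eq → toℕ-injective (edge-injective (toℕ<n _) (toℕ<n _) eq))
      , adjacent
      where
      adjacent : ∀ (i j : Fin len) → suc (toℕ i) ≡ toℕ j ⊎ (suc (toℕ i) ≡ len × toℕ j ≡ 0) →
                 Joins G (edge (toℕ i)) (vertex (toℕ i)) (vertex (toℕ j))
      adjacent i j (inj₁ i+1≡j)           = subst (Joins G _ _ ∘ vertex) i+1≡j (edge-joins (toℕ<n i))
      adjacent i j (inj₂ (i+1≡len , j≡0)) =
        subst (Joins G _ _) (trans (cong vertex i+1≡len) (trans closed (cong vertex (sym j≡0))))
              (edge-joins (toℕ<n i))

  module Walk {X} (deg02 : DegreeZeroOrTwo X) {w₀ f₀} (f₀∈X : f₀ ∈ X) (Inc-f₀ : Inc w₀ f₀) where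
    open Partner

    record Step : Set where
      constructor step
      field
        at      : V
        via     : E
        via∈X   : via ∈ X
        Inc-via : Inc at via
    open Step

    far : Step → V
    far s = proj₁ (Inc⇒joins (Inc-via s))

    via-joins : ∀ s → Joins G (via s) (at s) (far s)
    via-joins s = proj₂ (Inc⇒joins (Inc-via s))

    partner : ∀ s → Partner X (far s) (via s)
    partner s = deg02 (via∈X s) (joins⇒Incʳ (via-joins s))

    next : Step → Step
    next s = step (far s) (edge (partner s)) (edge∈X (partner s)) (Inc-edge (partner s))

    walk : ℕ → Step
    walk zero    = step w₀ f₀ f₀∈X Inc-f₀
    walk (suc i) = next (walk i)

    W : ℕ → V
    W = at ∘ walk

    F : ℕ → E
    F = via ∘ walk

    F-joins : ∀ i → Joins G (F i) (W i) (W (suc i))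
    F-joins i = via-joins (walk i)

    F-backtrack-free : ∀ i → F (suc i) ≢ F i
    F-backtrack-free i = edge≢f (partner (walk i))

    Repeats : ℕ → Set
    Repeats j = ∃[ i ] i < j × W i ≡ W j

    firstRepeat : ∃[ j ] Repeats j × (∀ {j′} → j′ < j → ¬ Repeats j′)
    firstRepeat with Finₚ.pigeonhole (n<1+n (n G)) (W ∘ toℕ)
    ... | i , j , i<j , Wi≡Wj = least (λ j → anyUpTo? (λ i → W i Fin.≟ W j) j) (toℕ i , i<j , Wi≡Wj)

    J : ℕ
    J = proj₁ firstRepeat

    I : ℕ
    I = proj₁ (proj₁ (proj₂ firstRepeat))

    I<J : I < J
    I<J = proj₁ (proj₂ (proj₁ (proj₂ firstRepeat)))

    WI≡WJ : W I ≡ W J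
    WI≡WJ = proj₂ (proj₂ (proj₁ (proj₂ firstRepeat)))

    no-earlier-repeat : ∀ {j} → j < J → ¬ Repeats j
    no-earlier-repeat = proj₂ (proj₂ firstRepeat)

    W-injective : ∀ {a b} → a < J → b < J → W a ≡ W b → a ≡ b
    W-injective {a} {b} a<J b<J Wa≡Wb with <-cmp a b
    ... | tri< a<b _ _ = ⊥-elim (no-earlier-repeat b<J (a , a<b , Wa≡Wb))
    ... | tri≈ _ a≡b _ = a≡b
    ... | tri> _ _ b<a = ⊥-elim (no-earlier-repeat a<J (b , b<a , sym Wa≡Wb))

    F-at : ∀ {i j} → W i ≡ W (suc j) → Joins G (F j) (W i) (W j)
    F-at {i} {j} Wi≡Wj+1 = subst (λ w → Joins G (F j) w (W j)) (sym Wi≡Wj+1) (joins-sym (F-joins j))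

    -- A first repetition can only close up at W 0: at any later vertex the walk already used both X-edges.
    repeat-starts-at-0 : ∀ {i j} → i < j → W i ≡ W j → (∀ {j′} → j′ < j → ¬ Repeats j′) → i ≡ 0
    repeat-starts-at-0 {zero} _ _ _ = refl
    repeat-starts-at-0 {suc i} {suc j} (s≤s i<j) Wi+1≡Wj+1 minimal
      with unique (partner (walk i)) (via∈X (walk j)) (joins⇒Incˡ (F-at {suc i} {j} Wi+1≡Wj+1))
    ... | inj₁ Fj≡Fi =
      ⊥-elim (minimal ≤-refl (i , i<j , joins-determined (joins-sym (F-joins i))
                                          (subst (λ f → Joins G f (W (suc i)) (W j)) Fj≡Fi (F-at {suc i} {j} Wi+1≡Wj+1))))
    ... | inj₂ Fj≡Fi+1 with joins-determined (F-joins (suc i))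
                             (subst (λ f → Joins G f (W (suc i)) (W j)) Fj≡Fi+1 (F-at {suc i} {j} Wi+1≡Wj+1))
    ...   | Wi+2≡Wj with <-cmp (suc (suc i)) j
    ...     | tri< i+2<j _ _ = ⊥-elim (minimal ≤-refl (suc (suc i) , i+2<j , Wi+2≡Wj))
    ...     | tri≈ _ refl _  = ⊥-elim (F-backtrack-free (suc i) Fj≡Fi+1)
    ...     | tri> _ _ j<i+2 = ⊥-elim (joins⇒≢ (F-joins (suc i))
                                 (sym (trans Wi+2≡Wj (cong W (≤-antisym (≤-pred j<i+2) i<j)))))

    I≡0 : I ≡ 0
    I≡0 = repeat-starts-at-0 I<J WI≡WJ no-earlier-repeat

    closed : W J ≡ W 0
    closed = trans (sym WI≡WJ) (cong W I≡0)

    -- An edge met twice is met again at once and backwards (b = a + 1); then W a = W (a + 2)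
    -- forces a + 2 = J and a = 0, which is backtracking.
    F-distinct : ∀ {a b} → a < b → b < J → F a ≢ F b
    F-distinct {a} {b} a<b b<J Fa≡Fb
      with joins-unique (F-joins a) (subst (λ f → Joins G f (W b) (W (suc b))) (sym Fa≡Fb) (F-joins b))
    ... | inj₁ (Wa≡Wb , _) = <-irrefl (W-injective (<-trans a<b b<J) b<J Wa≡Wb) a<b
    ... | inj₂ (Wa≡Wb+1 , Wa+1≡Wb) with W-injective (≤-<-trans a<b b<J) b<J Wa+1≡Wb
    ...   | refl with <-cmp (suc (suc a)) J
    ...     | tri< a+2<J _ _ = <-irrefl (W-injective (<-trans a<b b<J) a+2<J Wa≡Wb+1) (s≤s (n≤1+n a))
    ...     | tri> _ _ J<a+2 = <-irrefl refl (<-≤-trans J<a+2 b<J)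
    ...     | tri≈ _ a+2≡J _ with W-injective (<-trans a<b b<J) (≤-<-trans z≤n (<-trans a<b b<J))
                                   (trans Wa≡Wb+1 (trans (cong W a+2≡J) closed))
    ...       | refl = F-backtrack-free 0 (sym Fa≡Fb)

    F-injective : ∀ {a b} → a < J → b < J → F a ≡ F b → a ≡ b
    F-injective {a} {b} a<J b<J Fa≡Fb with <-cmp a b
    ... | tri< a<b _ _ = ⊥-elim (F-distinct a<b b<J Fa≡Fb)
    ... | tri≈ _ a≡b _ = a≡b
    ... | tri> _ _ b<a = ⊥-elim (F-distinct b<a a<J (sym Fa≡Fb))

    J≥2 : 2 ≤ J
    J≥2 with J | I<J | closed
    ... | suc zero    | _ | W1≡W0 = ⊥-elim (joins⇒≢ (F-joins 0) (sym W1≡W0))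
    ... | suc (suc _) | _ | _     = s≤s (s≤s z≤n)

    cycle : Cycle X
    cycle = record
      { len = J ; vertex = W ; edge = F ; len≥2 = J≥2 ; closed = closed
      ; vertex-injective = W-injective ; edge-injective = F-injective
      ; edge-joins = λ {i} _ → F-joins i ; edge∈X = λ {i} _ → via∈X (walk i) }

  cycleThrough : ∀ {X} → DegreeZeroOrTwo X → ∀ {w f} → f ∈ X → Inc w f →
    Σ (Cycle X) λ D → Cycle.vertex D 0 ≡ w × Cycle.edge D 0 ≡ f
  cycleThrough deg02 f∈X Inc-f = Walk.cycle deg02 f∈X Inc-f , refl , refl

  module _ {X : EdgeSet G} (D : Cycle X) where
    open Cycle D

    len≤∣∣ : ∀ {Y} → (∀ {i} → i < len → edge i ∈ Y) → len ≤ ∣ Y ∣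
    len≤∣∣ {Y} edge∈Y = members-≤-∣∣ Y (edge ∘ toℕ)
      (λ eq → toℕ-injective (edge-injective (toℕ<n _) (toℕ<n _) eq)) (λ i → edge∈Y (toℕ<n i))

    endpoint-on-cycle : ∀ {i v} → i < len → Inc v (edge i) → ∃[ a ] a < len × vertex a ≡ v
    endpoint-on-cycle {i} i<len Inc-v with joins-endpoint (edge-joins i<len) Inc-v
    ... | inj₁ v≡ = i , i<len , sym v≡
    ... | inj₂ v≡ with m≤n⇒m<n∨m≡n i<len
    ...   | inj₁ i+1<len = suc i , i+1<len , sym v≡
    ...   | inj₂ i+1≡len = 0 , 0<len , trans (sym closed) (trans (cong vertex (sym i+1≡len)) (sym v≡))

    other-cycle-edge : ∀ {a} → a < len → ∃[ b ] b < len × b ≢ a × Inc (vertex a) (edge b)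
    other-cycle-edge {suc a} a+1<len = a , <-trans (n<1+n a) a+1<len , 1+n≢n ∘ sym , joins⇒Incʳ (edge-joins (<-trans (n<1+n a) a+1<len))
    other-cycle-edge {zero}  _ = last , last<len , last≢0 , Inc-vertex0-last

    vertex-injective-≤ : ∀ {i j} → i ≤ len → j ≤ len → vertex i ≡ vertex j →
      i ≡ j ⊎ (i ≡ 0 × j ≡ len) ⊎ (i ≡ len × j ≡ 0)
    vertex-injective-≤ i≤len j≤len vi≡vj with m≤n⇒m<n∨m≡n i≤len | m≤n⇒m<n∨m≡n j≤len
    ... | inj₁ i<len | inj₁ j<len = inj₁ (vertex-injective i<len j<len vi≡vj)
    ... | inj₁ i<len | inj₂ refl  = inj₂ (inj₁ (vertex-injective i<len 0<len (trans vi≡vj closed) , refl))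
    ... | inj₂ refl  | inj₁ j<len = inj₂ (inj₂ (refl , sym (vertex-injective 0<len j<len (trans (sym closed) vi≡vj))))
    ... | inj₂ refl  | inj₂ refl  = inj₁ refl

    -- The arc vertex s, …, vertex (s + d) of D closed up by a chord e.
    module Chord {s d e} (d≥1 : 1 ≤ d) (s+d≤len : s + d ≤ len) (not-all : ¬ (s ≡ 0 × s + d ≡ len))
                 (e-joins : Joins G e (vertex (s + d)) (vertex s)) (e∉D : e ∉ edgeSet) where

      vertex′ : ℕ → V
      vertex′ a with a ≤? d
      ... | yes _ = vertex (s + a)
      ... | no _  = vertex s

      edge′ : ℕ → E
      edge′ a with a <? d
      ... | yes _ = edge (s + a)
      ... | no _  = e

      vertex′-arc : ∀ {a} → a ≤ d → vertex′ a ≡ vertex (s + a)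
      vertex′-arc {a} a≤d with a ≤? d
      ... | yes _   = refl
      ... | no a≰d  = ⊥-elim (a≰d a≤d)

      vertex′-end : vertex′ (suc d) ≡ vertex s
      vertex′-end with suc d ≤? d
      ... | yes d+1≤d = ⊥-elim (1+n≰n d+1≤d)
      ... | no _      = refl

      edge′-arc : ∀ {a} → a < d → edge′ a ≡ edge (s + a)
      edge′-arc {a} a<d with a <? d
      ... | yes _  = refl
      ... | no a≮d = ⊥-elim (a≮d a<d)

      edge′-chord : edge′ d ≡ e
      edge′-chord with d <? d
      ... | yes d<d = ⊥-elim (<-irrefl refl d<d)
      ... | no _    = refl

      s+a≤len : ∀ {a} → a ≤ d → s + a ≤ len
      s+a≤len a≤d = ≤-trans (+-monoʳ-≤ s a≤d) s+d≤len

      s+a<len : ∀ {a} → a < d → s + a < len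
      s+a<len {a} a<d = subst (_≤ len) (+-suc s a) (s+a≤len a<d)

      vertex′-injective : ∀ {a b} → a < suc d → b < suc d → vertex′ a ≡ vertex′ b → a ≡ b
      vertex′-injective (s≤s a≤d) (s≤s b≤d) eq
        with vertex-injective-≤ (s+a≤len a≤d) (s+a≤len b≤d)
               (trans (sym (vertex′-arc a≤d)) (trans eq (vertex′-arc b≤d)))
      ... | inj₁ s+a≡s+b           = +-cancelˡ-≡ s _ _ s+a≡s+b
      ... | inj₂ (inj₁ (s+a≡0 , s+b≡len)) =
        ⊥-elim (not-all (m+n≡0⇒m≡0 s s+a≡0 , ≤-antisym s+d≤len (subst (_≤ s + d) s+b≡len (+-monoʳ-≤ s b≤d))))
      ... | inj₂ (inj₂ (s+a≡len , s+b≡0)) =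
        ⊥-elim (not-all (m+n≡0⇒m≡0 s s+b≡0 , ≤-antisym s+d≤len (subst (_≤ s + d) s+a≡len (+-monoʳ-≤ s a≤d))))

      edge′-injective : ∀ {a b} → a < suc d → b < suc d → edge′ a ≡ edge′ b → a ≡ b
      edge′-injective {a} {b} (s≤s a≤d) (s≤s b≤d) eq with m≤n⇒m<n∨m≡n a≤d | m≤n⇒m<n∨m≡n b≤d
      ... | inj₁ a<d | inj₁ b<d = +-cancelˡ-≡ s _ _ (edge-injective (s+a<len a<d) (s+a<len b<d)
                                     (trans (sym (edge′-arc a<d)) (trans eq (edge′-arc b<d))))
      ... | inj₁ a<d | inj₂ refl = ⊥-elim (e∉D (subst (_∈ edgeSet) (trans (sym (edge′-arc a<d)) (trans eq edge′-chord))
                                                   (edge∈edgeSet (s+a<len a<d))))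
      ... | inj₂ refl | inj₁ b<d = ⊥-elim (e∉D (subst (_∈ edgeSet) (trans (sym (edge′-arc b<d)) (trans (sym eq) edge′-chord))
                                                   (edge∈edgeSet (s+a<len b<d))))
      ... | inj₂ refl | inj₂ refl = refl

      edge′-joins : ∀ {a} → a < suc d → Joins G (edge′ a) (vertex′ a) (vertex′ (suc a))
      edge′-joins {a} (s≤s a≤d) with m≤n⇒m<n∨m≡n a≤d
      ... | inj₁ a<d = subst₂ (λ f u → Joins G f u (vertex′ (suc a))) (sym (edge′-arc a<d)) (sym (vertex′-arc a≤d))
                         (subst (Joins G (edge (s + a)) (vertex (s + a)))
                                (trans (cong vertex (sym (+-suc s a))) (sym (vertex′-arc a<d)))
                                (edge-joins (s+a<len a<d)))
      ... | inj₂ refl = subst₂ (λ f u → Joins G f u (vertex′ (suc d))) (sym edge′-chord) (sym (vertex′-arc ≤-refl))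
                          (subst (Joins G e (vertex (s + d))) (sym vertex′-end) e-joins)

      circuit : Circuit G (suc d)
      circuit = Cycle.toCircuit {allEdges G} (record
        { len = suc d ; vertex = vertex′ ; edge = edge′
        ; len≥2 = s≤s d≥1
        ; closed = trans vertex′-end (trans (cong vertex (sym (+-identityʳ s))) (sym (vertex′-arc z≤n)))
        ; vertex-injective = vertex′-injective ; edge-injective = edge′-injective
        ; edge-joins = edge′-joins ; edge∈X = λ _ → Equivalence.from ∈-tabulate refl })

    onCycle? : ∀ w → Dec (∃[ a ] a < len × vertex a ≡ w)
    onCycle? w = anyUpTo? (λ a → vertex a Fin.≟ w) len

    recolour : (V → Bool) → V → Bool
    recolour c w with onCycle? w
    ... | yes (a , _) = oddᵇ a
    ... | no _        = c w

    recolour-on : ∀ c {a} → a < len → recolour c (vertex a) ≡ oddᵇ a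
    recolour-on c {a} a<len with onCycle? (vertex a)
    ... | yes (b , b<len , vb≡va) = cong oddᵇ (vertex-injective b<len a<len vb≡va)
    ... | no off                  = ⊥-elim (off (a , a<len , refl))

    recolour-off : ∀ c {w} → (∀ {a} → a < len → vertex a ≢ w) → recolour c w ≡ c w
    recolour-off c {w} off with onCycle? w
    ... | yes (a , a<len , va≡w) = ⊥-elim (off a<len va≡w)
    ... | no _                   = refl

    recolour-proper : ∀ c → oddᵇ len ≡ false → ∀ {a} → a < len →
      recolour c (src G (edge a)) ≢ recolour c (tgt G (edge a))
    recolour-proper c even {a} a<len = joins-proper {c = recolour c} (edge-joins a<len) differ
      where
      differ : recolour c (vertex a) ≢ recolour c (vertex (suc a))
      differ with m≤n⇒m<n∨m≡n a<len
      ... | inj₁ a+1<len = subst₂ _≢_ (sym (recolour-on c a<len)) (sym (recolour-on c a+1<len))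
                             (not-¬ refl)
      ... | inj₂ a+1≡len = subst₂ _≢_ (sym (recolour-on c a<len))
                             (sym (trans (cong (recolour c ∘ vertex) a+1≡len) (trans (cong (recolour c) closed) (recolour-on c 0<len))))
                             (λ oa≡false → not-¬ refl (sym (trans (cong oddᵇ a+1≡len) (trans even (sym oa≡false)))))

    alternating⇒even : ∀ {label} → Alternating label X → oddᵇ len ≡ false
    alternating⇒even {label} alt = begin
      oddᵇ len                 ≡⟨ cong oddᵇ last+1≡len ⟨
      not (oddᵇ last)          ≡⟨ cong not (alternating⇒oddᵇ (label ∘ edge) step) ⟩
      not (f 0 xor f last)     ≡⟨ cong (λ b → not (f 0 xor b)) wrap ⟩
      not (f 0 xor not (f 0))  ≡⟨ cong not (not-distribʳ-xor (f 0) (f 0)) ⟨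
      not (not (f 0 xor f 0))  ≡⟨ not-involutive _ ⟩
      f 0 xor f 0              ≡⟨ xor-same (f 0) ⟩
      false                    ∎
      where
      open ≡-Reasoning
      f : ℕ → Bool
      f = label ∘ edge
      step : ∀ {a} → a < last → f (suc a) ≡ not (f a)
      step {a} a<last = alt (edge∈X a+1<len) (edge∈X a<len) (joins⇒Incˡ (edge-joins a+1<len))
                            (joins⇒Incʳ (edge-joins a<len)) (1+n≢n ∘ edge-injective a+1<len a<len)
        where
        a+1<len : suc a < len
        a+1<len = subst (suc a <_) last+1≡len (s≤s a<last)
        a<len : a < len
        a<len = <-trans (n<1+n a) a+1<len
      wrap : f last ≡ not (f 0)
      wrap = alt (edge∈X last<len) (edge∈X 0<len) Inc-vertex0-last (joins⇒Incˡ (edge-joins 0<len))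
                 (last≢0 ∘ edge-injective last<len 0<len)

  module _ {X} (deg02 : DegreeZeroOrTwo X) (D : Cycle X) where
    open Cycle D

    -- At a cycle vertex both X-edges are cycle edges, so an X-edge off the cycle cannot meet it.
    off-cycle : ∀ {f v} → f ∈ X → f ∉ edgeSet → Inc v f → ∀ {a} → a < len → vertex a ≢ v
    off-cycle f∈X f∉D Inc-f {a} a<len refl
      with other-cycle-edge D a<len
    ... | b , b<len , b≢a , Inc-eb
      with Partner.unique (deg02 (edge∈X a<len) (joins⇒Incˡ (edge-joins a<len))) f∈X Inc-f
         | Partner.unique (deg02 (edge∈X a<len) (joins⇒Incˡ (edge-joins a<len))) (edge∈X b<len) Inc-eb
    ...   | inj₁ f≡ea | _          = f∉D (subst (_∈ edgeSet) (sym f≡ea) (edge∈edgeSet a<len))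
    ...   | inj₂ _    | inj₁ eb≡ea = b≢a (edge-injective b<len a<len eb≡ea)
    ...   | inj₂ f≡g  | inj₂ eb≡g  = f∉D (subst (_∈ edgeSet) (trans eb≡g (sym f≡g)) (edge∈edgeSet b<len))

    removeCycle : DegreeZeroOrTwo (X ─ edgeSet)
    removeCycle {v} {f} f∈X─D Inc-f = record
      { edge = Partner.edge P ; edge∈X = x∈p∧x∉q⇒x∈p─q (Partner.edge∈X P) g∉D
      ; Inc-edge = Partner.Inc-edge P ; edge≢f = Partner.edge≢f P
      ; unique = λ h∈X─D → Partner.unique P (p─q⊆p X edgeSet h∈X─D) }
      where
      f∈X : f ∈ X
      f∈X = p─q⊆p X edgeSet f∈X─D
      P : Partner X v f
      P = deg02 f∈X Inc-f
      g∉D : Partner.edge P ∉ edgeSet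
      g∉D g∈D with Equivalence.to ∈edgeSet⇔ g∈D
      ... | i , i<len , ei≡g with endpoint-on-cycle D i<len (subst (Inc v) (sym ei≡g) (Partner.Inc-edge P))
      ...   | a , a<len , va≡v = off-cycle f∈X (x∈p─q⇒x∉q f∈X─D) Inc-f a<len va≡v

  module _ (label : E → Bool) where

    private
      Colourable : ℕ → Set
      Colourable k = ∀ {X} → ∣ X ∣ ≡ k → DegreeZeroOrTwo X → Alternating label X → IsBipartite G X

      peel-cycle : ∀ k → (∀ {j} → j < k → Colourable j) → Colourable k
      peel-cycle k colourable-below {X} refl deg02 alt with nonempty? X
      ... | no empty      = (λ _ → false) , λ e e∈X → ⊥-elim (empty (e , e∈X))
      ... | yes (e , e∈X) = recolour D c , proper
        where
        D : Cycle X
        D = proj₁ (cycleThrough deg02 e∈X (joins⇒Incˡ src-joins-tgt))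
        open Cycle D using (len; edge; edgeSet; occurs?; 0<len; edge∈X; edge∈edgeSet)
        rest : IsBipartite G (X ─ edgeSet)
        rest = colourable-below
                 (p∩q≢∅⇒∣p─q∣<∣p∣ X edgeSet (edge 0 , x∈p∩q⁺ (edge∈X 0<len , edge∈edgeSet 0<len))) refl
                 (removeCycle deg02 D) (λ f∈ g∈ → alt (p─q⊆p X edgeSet f∈) (p─q⊆p X edgeSet g∈))
        c : V → Bool
        c = proj₁ rest
        proper : ∀ f → f ∈ X → recolour D c (src G f) ≢ recolour D c (tgt G f)
        proper f f∈X = by-occurrence (occurs? f)
          where
          by-occurrence : Dec (∃[ a ] a < len × edge a ≡ f) → recolour D c (src G f) ≢ recolour D c (tgt G f)
          by-occurrence (yes (a , a<len , refl)) = recolour-proper D c (alternating⇒even D alt) a<len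
          by-occurrence (no f∉D) = subst₂ _≢_ (sym (recolour-off D c (off (joins⇒Incˡ src-joins-tgt))))
                                             (sym (recolour-off D c (off (joins⇒Incʳ src-joins-tgt))))
                                             (proj₂ rest f (x∈p∧x∉q⇒x∈p─q f∈X f∉edgeSet))
            where
            f∉edgeSet : f ∉ edgeSet
            f∉edgeSet = f∉D ∘ Equivalence.to (Cycle.∈edgeSet⇔ D)
            off : ∀ {w} → Inc w f → ∀ {a} → a < len → Cycle.vertex D a ≢ w
            off = off-cycle deg02 D f∈X f∉edgeSet

    alternating⇒bipartite : ∀ {X} → DegreeZeroOrTwo X → Alternating label X → IsBipartite G X
    alternating⇒bipartite = <-rec Colourable peel-cycle _ refl

-- Three 1-factors at a cubic vertex
Class : Set
Class = Bool → Bool → Bool → Bool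

-- Classes of an edge by its membership (x, y, z) in M₁, M₂, M₃: evenlyCovered means in 0 or 2 of
-- them, and inCore is membership in 𝓜 ∪ 𝓤.
uncovered triple evenlyCovered inCore : Class
uncovered x y z     = not (x ∨ (y ∨ z))
triple x y z        = x ∧ (y ∧ z)
evenlyCovered x y z = not (x xor (y xor z))
inCore x y z        = ((x ∧ y) ∨ ((x ∧ z) ∨ (y ∧ z))) ∨ uncovered x y z

inCore⇒evenlyCovered⊎triple : ∀ x y z → inCore x y z ≡ true →
  evenlyCovered x y z ≡ true ⊎ triple x y z ≡ true
inCore⇒evenlyCovered⊎triple true  true  true  _ = inj₂ refl
inCore⇒evenlyCovered⊎triple true  true  false _ = inj₁ refl
inCore⇒evenlyCovered⊎triple true  false true  _ = inj₁ refl
inCore⇒evenlyCovered⊎triple false true  true  _ = inj₁ refl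
inCore⇒evenlyCovered⊎triple false false false _ = inj₁ refl

evenlyCovered⇒¬triple : ∀ x y z → evenlyCovered x y z ≡ true → triple x y z ≢ true
evenlyCovered⇒¬triple true true true ()

-- The configuration at a cubic vertex: M_i uses the incident edge in position p_i.
module Configuration (p₁ p₂ p₃ : Fin 3) where

  at : Class → Fin 3 → Bool
  at c q = c (does (p₁ Fin.≟ q)) (does (p₂ Fin.≟ q)) (does (p₃ Fin.≟ q))

  count : Class → ℕ
  count c = ∑[ q < 3 ] indicator (at c q)

  NoTriple : Set
  NoTriple = ∀ q → at triple q ≡ false


-- Each fact is decided by evaluation over the 27 configurations; abstract keeps the evaluation local.
abstract
  balance : ∀ p₁ p₂ p₃ → let open Configuration p₁ p₂ p₃ in
    count evenlyCovered + 2 * count triple ≡ 2 * count uncovered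
  balance = from-yes (all? λ p₁ → all? λ p₂ → all? λ p₃ → let open Configuration p₁ p₂ p₃ in
    count evenlyCovered + 2 * count triple ℕ.≟ 2 * count uncovered)

  evenlyCovered-partner : ∀ p₁ p₂ p₃ → let open Configuration p₁ p₂ p₃ in
    ∀ q → at evenlyCovered q ≡ true →
    ∃[ r ] r ≢ q × at evenlyCovered r ≡ true × (∀ s → at evenlyCovered s ≡ true → s ≡ q ⊎ s ≡ r)
  evenlyCovered-partner = from-yes (all? λ p₁ → all? λ p₂ → all? λ p₃ → let open Configuration p₁ p₂ p₃ in
    all? λ q → (at evenlyCovered q Bool.≟ true) →-dec any? λ r → ¬? (r Fin.≟ q) ×-dec
      ((at evenlyCovered r Bool.≟ true) ×-dec
       all? λ s → (at evenlyCovered s Bool.≟ true) →-dec ((s Fin.≟ q) ⊎-dec (s Fin.≟ r))))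

  noTriple? : ∀ p₁ p₂ p₃ → Dec (Configuration.NoTriple p₁ p₂ p₃)
  noTriple? p₁ p₂ p₃ = all? λ q → Configuration.at p₁ p₂ p₃ triple q Bool.≟ false

  alternation : ∀ p₁ p₂ p₃ → let open Configuration p₁ p₂ p₃ in
    NoTriple → ∀ q r → q ≢ r → at evenlyCovered q ≡ true → at evenlyCovered r ≡ true →
    at uncovered q ≡ not (at uncovered r)
  alternation = from-yes (all? λ p₁ → all? λ p₂ → all? λ p₃ → let open Configuration p₁ p₂ p₃ in
    noTriple? p₁ p₂ p₃ →-dec all? λ q → all? λ r → ¬? (q Fin.≟ r) →-dec
      ((at evenlyCovered q Bool.≟ true) →-dec ((at evenlyCovered r Bool.≟ true) →-dec
        (at uncovered q Bool.≟ not (at uncovered r)))))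

  triple⇒uncovered : ∀ p₁ p₂ p₃ → let open Configuration p₁ p₂ p₃ in
    ∀ q r → at triple q ≡ true → at evenlyCovered r ≡ true → at uncovered r ≡ true
  triple⇒uncovered = from-yes (all? λ p₁ → all? λ p₂ → all? λ p₃ → let open Configuration p₁ p₂ p₃ in
    all? λ q → all? λ r → (at triple q Bool.≟ true) →-dec ((at evenlyCovered r Bool.≟ true) →-dec
      (at uncovered r Bool.≟ true)))

  triple⇒evenlyCovered : ∀ p₁ p₂ p₃ → let open Configuration p₁ p₂ p₃ in
    ∀ q → at triple q ≡ true → ∃[ r ] at evenlyCovered r ≡ true
  triple⇒evenlyCovered = from-yes (all? λ p₁ → all? λ p₂ → all? λ p₃ → let open Configuration p₁ p₂ p₃ in
    all? λ q → (at triple q Bool.≟ true) →-dec any? λ r → at evenlyCovered r Bool.≟ true)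

  noTriple⇒core-even : ∀ p₁ p₂ p₃ → let open Configuration p₁ p₂ p₃ in
    NoTriple → 2 ∣ count inCore
  noTriple⇒core-even = from-yes (all? λ p₁ → all? λ p₂ → all? λ p₃ →
    noTriple? p₁ p₂ p₃ →-dec (2 ∣? Configuration.count p₁ p₂ p₃ inCore))

one-hot : ∀ (b : Fin 3 → Bool) → ∑[ q < 3 ] indicator (b q) ≡ 1 → ∃[ p ] ∀ q → b q ≡ does (p Fin.≟ q)
one-hot b sum≡1 with b zero in b₀ | b (suc zero) in b₁ | b (suc (suc zero)) in b₂
... | true  | false | false = zero , λ { zero → b₀ ; (suc zero) → b₁ ; (suc (suc zero)) → b₂ }
... | false | true  | false = suc zero , λ { zero → b₀ ; (suc zero) → b₁ ; (suc (suc zero)) → b₂ }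
... | false | false | true  = suc (suc zero) , λ { zero → b₀ ; (suc zero) → b₁ ; (suc (suc zero)) → b₂ }
one-hot b () | true  | true  | _
one-hot b () | true  | false | true
one-hot b () | false | true  | true
one-hot b () | false | false | false

module Core (G : Graph) (cubic : Cubic G) (M₁ M₂ M₃ : EdgeSet G)
            (f₁ : IsOneFactor G M₁) (f₂ : IsOneFactor G M₂) (f₃ : IsOneFactor G M₃) where
  open GraphBasics G
  open Cycles G

  classOf : Class → E → Bool
  classOf c e = c (lookup M₁ e) (lookup M₂ e) (lookup M₃ e)

  edgesOf : Class → EdgeSet G
  edgesOf c = tabulate (classOf c)

  Z T U : EdgeSet G
  Z = edgesOf evenlyCovered
  T = edgesOf triple
  U = edgesOf uncovered

  ∣incident∣≡3 : ∀ v → ∣ incident G v ∣ ≡ 3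
  ∣incident∣≡3 v = trans (cong ∣_∣ (sym (trans (cong (_∩ incident G v) allEdges≡⊤) (∩-identityˡ _)))) (cubic v)
    where
    allEdges≡⊤ : allEdges G ≡ ⊤
    allEdges≡⊤ = trans (tabulate-cong (λ e → sym (lookup-replicate e true))) (tabulate∘lookup ⊤)

  record LocalView (v : V) : Set where
    field
      star         : Enumeration (incident G v) 3
      p₁ p₂ p₃     : Fin 3
      classOf-elem : ∀ c q → classOf c (Enumeration.elem star q) ≡ Configuration.at p₁ p₂ p₃ c q

  localView : ∀ v → LocalView v
  localView v = record
    { star = star ; p₁ = proj₁ (position M₁ f₁) ; p₂ = proj₁ (position M₂ f₂) ; p₃ = proj₁ (position M₃ f₃)
    ; classOf-elem = λ c q → cong₃ c (proj₂ (position M₁ f₁) q) (proj₂ (position M₂ f₂) q) (proj₂ (position M₃ f₃) q) }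
    where
    star : Enumeration (incident G v) 3
    star = subst (Enumeration (incident G v)) (∣incident∣≡3 v) (enumerate (incident G v))
    open Enumeration star
    position : ∀ M → IsOneFactor G M → ∃[ p ] ∀ q → lookup M (elem q) ≡ does (p Fin.≟ q)
    position M factor = one-hot (lookup M ∘ elem) (trans (sym (∣∩∣≡∑ M)) (factor v))
    cong₃ : ∀ (c : Class) {x y z x′ y′ z′} → x ≡ x′ → y ≡ y′ → z ≡ z′ → c x y z ≡ c x′ y′ z′
    cong₃ c refl refl refl = refl

  module AtVertex (v : V) where
    open LocalView (localView v)
    open Enumeration star
    open Configuration p₁ p₂ p₃ using (at; count; NoTriple)

    elem∈⇒at : ∀ c {q} → elem q ∈ edgesOf c → at c q ≡ true
    elem∈⇒at c {q} e∈ = trans (sym (classOf-elem c q)) (Equivalence.to ∈-tabulate e∈)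

    at⇒elem∈ : ∀ c {q} → at c q ≡ true → elem q ∈ edgesOf c
    at⇒elem∈ c {q} at≡ = Equivalence.from ∈-tabulate (trans (classOf-elem c q) at≡)

    deg-edgesOf : ∀ c → deg G (edgesOf c) v ≡ count c
    deg-edgesOf c = trans (∣∩∣≡∑ (edgesOf c))
      (sum-cong-≗ {3} λ q → cong indicator (trans (lookup∘tabulate (classOf c) (elem q)) (classOf-elem c q)))

    balance-at : deg G Z v + 2 * deg G T v ≡ 2 * deg G U v
    balance-at = begin
      deg G Z v + 2 * deg G T v                 ≡⟨ cong₂ (λ z t → z + 2 * t) (deg-edgesOf evenlyCovered) (deg-edgesOf triple) ⟩
      count evenlyCovered + 2 * count triple    ≡⟨ balance p₁ p₂ p₃ ⟩
      2 * count uncovered                       ≡⟨ cong (2 *_) (deg-edgesOf uncovered) ⟨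
      2 * deg G U v                             ∎
      where open ≡-Reasoning

    Z-partner : ∀ {f} → f ∈ Z → Inc v f → Partner Z v f
    Z-partner f∈Z Inc-f with ∈⇒elem Inc-f
    ... | q , refl with evenlyCovered-partner p₁ p₂ p₃ q (elem∈⇒at evenlyCovered f∈Z)
    ...   | r , r≢q , Zr , unique = record
      { edge = elem r ; edge∈X = at⇒elem∈ evenlyCovered Zr ; Inc-edge = elem-∈ r
      ; edge≢f = r≢q ∘ elem-injective ; unique = unique-elem }
      where
      unique-elem : ∀ {g} → g ∈ Z → Inc v g → g ≡ elem q ⊎ g ≡ elem r
      unique-elem g∈Z Inc-g with ∈⇒elem Inc-g
      ... | s , refl = Data.Sum.map (cong elem) (cong elem) (unique s (elem∈⇒at evenlyCovered g∈Z))

    TripleFree : Set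
    TripleFree = ∀ {e} → Inc v e → e ∉ T

    noTriple : TripleFree → NoTriple
    noTriple free q with at triple q in Tq
    ... | true  = ⊥-elim (free (elem-∈ q) (at⇒elem∈ triple Tq))
    ... | false = refl

    alternating-at : TripleFree → ∀ {f g} → f ∈ Z → g ∈ Z → Inc v f → Inc v g → f ≢ g →
      classOf uncovered f ≡ not (classOf uncovered g)
    alternating-at free f∈Z g∈Z Inc-f Inc-g f≢g with ∈⇒elem Inc-f | ∈⇒elem Inc-g
    ... | q , refl | r , refl =
      trans (classOf-elem uncovered q)
        (trans (alternation p₁ p₂ p₃ (noTriple free) q r (f≢g ∘ cong elem)
                  (elem∈⇒at evenlyCovered f∈Z) (elem∈⇒at evenlyCovered g∈Z))
               (cong not (sym (classOf-elem uncovered r))))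

    triple⇒Z-uncovered : ∀ {e g} → e ∈ T → Inc v e → g ∈ Z → Inc v g → g ∈ U
    triple⇒Z-uncovered e∈T Inc-e g∈Z Inc-g with ∈⇒elem Inc-e | ∈⇒elem Inc-g
    ... | q , refl | r , refl = at⇒elem∈ uncovered
      (triple⇒uncovered p₁ p₂ p₃ q r (elem∈⇒at triple e∈T) (elem∈⇒at evenlyCovered g∈Z))

    triple⇒Z-edge : ∀ {e} → e ∈ T → Inc v e → ∃[ g ] g ∈ Z × Inc v g
    triple⇒Z-edge e∈T Inc-e with ∈⇒elem Inc-e
    ... | q , refl with triple⇒evenlyCovered p₁ p₂ p₃ q (elem∈⇒at triple e∈T)
    ...   | r , Zr = elem r , at⇒elem∈ evenlyCovered Zr , elem-∈ r

    tripleFree⇒core-even : TripleFree → 2 ∣ deg G (edgesOf inCore) v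
    tripleFree⇒core-even free = subst (2 ∣_) (sym (deg-edgesOf inCore)) (noTriple⇒core-even p₁ p₂ p₃ (noTriple free))

  open AtVertex using (balance-at; Z-partner; TripleFree; alternating-at; triple⇒Z-uncovered;
                       triple⇒Z-edge; tripleFree⇒core-even)

  Z-degreeZeroOrTwo : DegreeZeroOrTwo Z
  Z-degreeZeroOrTwo {v} = Z-partner v

  ∣Z∣+2∣T∣≡2∣U∣ : ∣ Z ∣ + 2 * ∣ T ∣ ≡ 2 * ∣ U ∣
  ∣Z∣+2∣T∣≡2∣U∣ = *-cancelˡ-≡ _ _ 2 (begin
    2 * (∣ Z ∣ + 2 * ∣ T ∣)                                       ≡⟨ *-distribˡ-+ 2 ∣ Z ∣ (2 * ∣ T ∣) ⟩
    2 * ∣ Z ∣ + 2 * (2 * ∣ T ∣)                                   ≡⟨ cong₂ (λ z t → z + 2 * t) (handshake Z) (handshake T) ⟨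
    ∑[ v < n G ] deg G Z v + 2 * ∑[ v < n G ] deg G T v           ≡⟨ cong (∑[ v < n G ] deg G Z v +_) (*-distribˡ-sum {n G} 2 _) ⟩
    ∑[ v < n G ] deg G Z v + ∑[ v < n G ] (2 * deg G T v)         ≡⟨ ∑-distrib-+ {n G} (deg G Z) (λ v → 2 * deg G T v) ⟨
    ∑[ v < n G ] (deg G Z v + 2 * deg G T v)                      ≡⟨ sum-cong-≗ {n G} balance-at ⟩
    ∑[ v < n G ] (2 * deg G U v)                                  ≡⟨ *-distribˡ-sum {n G} 2 _ ⟨
    2 * ∑[ v < n G ] deg G U v                                    ≡⟨ cong (2 *_) (handshake U) ⟩
    2 * (2 * ∣ U ∣)                                               ∎)
    where open ≡-Reasoning

  calU≡U : calU {G} M₁ M₂ M₃ ≡ U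
  calU≡U = trans (sym (tabulate∘lookup _)) (tabulate-cong λ e →
    trans (lookup-map e not (M₁ ∪ (M₂ ∪ M₃)))
          (cong not (trans (lookup-zipWith _∨_ e M₁ (M₂ ∪ M₃)) (cong (lookup M₁ e ∨_) (lookup-zipWith _∨_ e M₂ M₃)))))

  core≡edgesOf-inCore : calM {G} M₁ M₂ M₃ ∪ calU {G} M₁ M₂ M₃ ≡ edgesOf inCore
  core≡edgesOf-inCore = trans (sym (tabulate∘lookup _)) (tabulate-cong λ e →
    trans (lookup-zipWith _∨_ e (calM {G} M₁ M₂ M₃) _)
          (cong₂ _∨_ (lookup-calM e) (trans (cong (λ X → lookup X e) calU≡U) (lookup∘tabulate _ e))))
    where
    lookup-∩ : ∀ (X Y : EdgeSet G) e → lookup (X ∩ Y) e ≡ lookup X e ∧ lookup Y e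
    lookup-∩ X Y e = lookup-zipWith _∧_ e X Y
    lookup-calM : ∀ e → lookup (calM {G} M₁ M₂ M₃) e ≡ (lookup M₁ e ∧ lookup M₂ e) ∨ ((lookup M₁ e ∧ lookup M₃ e) ∨ (lookup M₂ e ∧ lookup M₃ e))
    lookup-calM e = trans (lookup-zipWith _∨_ e (M₁ ∩ M₂) _) (cong₂ _∨_ (lookup-∩ M₁ M₂ e)
      (trans (lookup-zipWith _∨_ e (M₁ ∩ M₃) _) (cong₂ _∨_ (lookup-∩ M₁ M₃ e) (lookup-∩ M₂ M₃ e))))

  ∈core⇒Z⊎T : ∀ {e} → e ∈ edgesOf inCore → e ∈ Z ⊎ e ∈ T
  ∈core⇒Z⊎T {e} e∈H = Data.Sum.map (Equivalence.from ∈-tabulate) (Equivalence.from ∈-tabulate)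
    (inCore⇒evenlyCovered⊎triple (lookup M₁ e) (lookup M₂ e) (lookup M₃ e) (Equivalence.to ∈-tabulate e∈H))

  Z⇒∉T : ∀ {e} → e ∈ Z → e ∉ T
  Z⇒∉T {e} e∈Z e∈T = evenlyCovered⇒¬triple (lookup M₁ e) (lookup M₂ e) (lookup M₃ e) (Equivalence.to ∈-tabulate e∈Z) (Equivalence.to ∈-tabulate e∈T)

  tripleFree⇒core-bipartite : (∀ {e} → e ∉ T) → IsBipartite G (edgesOf inCore)
  tripleFree⇒core-bipartite free = c , λ e e∈H → [ proper e , ⊥-elim ∘ free ]′ (∈core⇒Z⊎T e∈H)
    where
    Z-alternating : Alternating (classOf uncovered) Z
    Z-alternating {v} = alternating-at v (λ _ → free)
    c = proj₁ (alternating⇒bipartite (classOf uncovered) Z-degreeZeroOrTwo Z-alternating)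
    proper = proj₂ (alternating⇒bipartite (classOf uncovered) Z-degreeZeroOrTwo Z-alternating)

  tripleFree⇒core-cyclic : (∀ {e} → e ∉ T) → IsCyclic G (edgesOf inCore)
  tripleFree⇒core-cyclic free v = tripleFree⇒core-even v (λ _ → free)

  record ChordedZCycle (e : E) : Set where
    field
      cycle   : Cycle Z
      q       : ℕ
      0<q     : 0 < q
      q<len   : q < Cycle.len cycle
      vertex0 : Cycle.vertex cycle 0 ≡ src G e
      vertexq : Cycle.vertex cycle q ≡ tgt G e
      Z⊆cycle : ∀ {g} → g ∈ Z → g ∈ Cycle.edgeSet cycle

  TwoDisjointCircuits : Set
  TwoDisjointCircuits = ∃[ ℓ ] ∃[ ℓ′ ] Circuit G ℓ × Circuit G ℓ′ × ℓ + ℓ′ ≤ ∣ Z ∣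

  triple⇒circuits : ∀ {e} → e ∈ T → TwoDisjointCircuits ⊎ ChordedZCycle e
  triple⇒circuits {e} e∈T with triple⇒Z-edge (src G e) e∈T (joins⇒Incˡ src-joins-tgt)
  ... | g , g∈Z , Inc-g with cycleThrough Z-degreeZeroOrTwo g∈Z Inc-g
  ...   | D , vertex0 , _ with nonempty? (Z ─ Cycle.edgeSet D)
  ...     | yes (h , h∈Z─D) = inj₁ (len , Cycle.len D′ , toCircuit , Cycle.toCircuit D′ , bound)
    where
    open Cycle D
    D′ : Cycle (Z ─ edgeSet)
    D′ = proj₁ (cycleThrough (removeCycle Z-degreeZeroOrTwo D) h∈Z─D (joins⇒Incˡ src-joins-tgt))
    bound : len + Cycle.len D′ ≤ ∣ Z ∣
    bound = begin
      len + Cycle.len D′                    ≤⟨ +-mono-≤ (len≤∣∣ D (λ i<len → x∈p∩q⁺ (edge∈X i<len , edge∈edgeSet i<len)))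
                                                        (len≤∣∣ D′ (Cycle.edge∈X D′)) ⟩
      ∣ Z ∩ edgeSet ∣ + ∣ Z ─ edgeSet ∣     ≡⟨ ∣p∣≡∣p∩q∣+∣p─q∣ Z edgeSet ⟨
      ∣ Z ∣                                 ∎
      where open ≤-Reasoning
  ...     | no Z⊆D with triple⇒Z-edge (tgt G e) e∈T (joins⇒Incʳ src-joins-tgt)
  ...       | g′ , g′∈Z , Inc-g′ with Equivalence.to (Cycle.∈edgeSet⇔ D) (empty-difference⇒⊆ Z⊆D g′∈Z)
  ...         | i , i<len , refl with endpoint-on-cycle D i<len Inc-g′
  ...           | q , q<len , vertexq = inj₂ (record
    { cycle = D ; q = q ; q<len = q<len ; vertex0 = vertex0 ; vertexq = vertexq
    ; Z⊆cycle = empty-difference⇒⊆ Z⊆D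
    ; 0<q = n≢0⇒n>0 λ { refl → noLoop G e (trans (sym vertex0) vertexq) } })

  module Chorded {e} (e∈T : e ∈ T) (C : ChordedZCycle e) where
    open ChordedZCycle C public
    open Cycle cycle public

    e∉cycle : e ∉ edgeSet
    e∉cycle e∈D with Equivalence.to ∈edgeSet⇔ e∈D
    ... | i , i<len , edge≡e = Z⇒∉T (subst (_∈ Z) edge≡e (edge∈X i<len)) e∈T

    q+[len∸q]≡len : q + (len ∸ q) ≡ len
    q+[len∸q]≡len = m+[n∸m]≡n (<⇒≤ q<len)

    chord-circuits : Circuit G (suc q) × Circuit G (suc (len ∸ q))
    chord-circuits =
      Chord.circuit cycle {0} {q} 0<q (<⇒≤ q<len) (λ (_ , q≡len) → <-irrefl q≡len q<len)
        (inj₂ (sym vertex0 , sym vertexq)) e∉cycle ,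
      Chord.circuit cycle {q} {len ∸ q} (m<n⇒0<n∸m q<len) (≤-reflexive q+[len∸q]≡len)
        (λ (q≡0 , _) → <-irrefl (sym q≡0) 0<q)
        (inj₁ (trans (sym vertex0) (trans (sym closed) (cong vertex (sym q+[len∸q]≡len))) , sym vertexq)) e∉cycle

    chord-lengths : suc q + suc (len ∸ q) ≡ suc (suc len)
    chord-lengths = cong suc (trans (+-suc q (len ∸ q)) (cong suc q+[len∸q]≡len))

    len≤∣Z∣ : len ≤ ∣ Z ∣
    len≤∣Z∣ = len≤∣∣ cycle edge∈X

    module Tight (∣T∣≤1 : ∣ T ∣ ≤ 1) (even : oddᵇ len ≡ false) where

      label : ℕ → Bool
      label = classOf uncovered ∘ edge

      Inc-vertex0 : Inc (vertex 0) e
      Inc-vertex0 = subst (λ w → Inc w e) (sym vertex0) (joins⇒Incˡ src-joins-tgt)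

      Inc-vertexq : Inc (vertex q) e
      Inc-vertexq = subst (λ w → Inc w e) (sym vertexq) (joins⇒Incʳ src-joins-tgt)

      -- e is the only triple edge.
      interior-tripleFree : ∀ {a} → 0 < a → a < q → TripleFree (vertex a)
      interior-tripleFree {a} 0<a a<q Inc-g g∈T with joins-endpoint src-joins-tgt
                                                       (subst (Inc (vertex a)) (∣p∣≤1⇒unique ∣T∣≤1 g∈T e∈T) Inc-g)
      ... | inj₁ va≡src = <-irrefl (sym (vertex-injective (<-trans a<q q<len) 0<len (trans va≡src (sym vertex0)))) 0<a
      ... | inj₂ va≡tgt = <-irrefl (vertex-injective (<-trans a<q q<len) q<len (trans va≡tgt (sym vertexq))) a<q

      label-end : ∀ {a w} → a < len → Inc w (edge a) → Inc w e → label a ≡ true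
      label-end {a} a<len Inc-w Inc-e = Equivalence.to ∈-tabulate (triple⇒Z-uncovered _ e∈T Inc-e (edge∈X a<len) Inc-w)

      q-odd : oddᵇ q ≡ true
      q-odd = begin
        oddᵇ q                  ≡⟨ cong oddᵇ p+1≡q ⟨
        not (oddᵇ p)            ≡⟨ cong not (alternating⇒oddᵇ label step) ⟩
        not (label 0 xor label p) ≡⟨ cong₂ (λ x y → not (x xor y))
                                      (label-end 0<len (joins⇒Incˡ (edge-joins 0<len)) Inc-vertex0)
                                      (label-end p<len (subst (λ a → Inc (vertex a) (edge p)) p+1≡q (joins⇒Incʳ (edge-joins p<len))) Inc-vertexq) ⟩
        true                    ∎
        where
        open ≡-Reasoning
        p : ℕ
        p = q ∸ 1
        p+1≡q : suc p ≡ q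
        p+1≡q = m+[n∸m]≡n 0<q
        p<len : p < len
        p<len = <-trans (subst (p <_) p+1≡q ≤-refl) q<len
        step : ∀ {a} → a < p → label (suc a) ≡ not (label a)
        step {a} a<p = alternating-at (vertex (suc a)) (interior-tripleFree z<s a+1<q)
                         (edge∈X a+1<len) (edge∈X a<len) (joins⇒Incˡ (edge-joins a+1<len))
                         (joins⇒Incʳ (edge-joins a<len)) (1+n≢n ∘ edge-injective a+1<len a<len)
          where
          a+1<q : suc a < q
          a+1<q = subst (suc a <_) p+1≡q (s≤s a<p)
          a+1<len : suc a < len
          a+1<len = <-trans a+1<q q<len
          a<len : a < len
          a<len = <-trans (n<1+n a) a+1<len

      core-bipartite : IsBipartite G (edgesOf inCore)
      core-bipartite = colour , λ g g∈H → [ Z-case , T-case ]′ (∈core⇒Z⊎T g∈H)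
        where
        colour : V → Bool
        colour = recolour cycle (λ _ → false)
        Z-case : ∀ {g} → g ∈ Z → colour (src G g) ≢ colour (tgt G g)
        Z-case g∈Z with Equivalence.to ∈edgeSet⇔ (Z⊆cycle g∈Z)
        ... | i , i<len , refl = recolour-proper cycle _ even i<len
        T-case : ∀ {g} → g ∈ T → colour (src G g) ≢ colour (tgt G g)
        T-case g∈T rewrite ∣p∣≤1⇒unique ∣T∣≤1 g∈T e∈T =
          subst₂ _≢_ (trans (sym (recolour-on cycle _ 0<len)) (cong colour vertex0))
                     (trans (sym (recolour-on cycle _ q<len)) (cong colour vertexq))
                     (λ false≡oddq → not-¬ refl (trans false≡oddq q-odd))

  module _ {k : ℕ} (∣U∣≡k : ∣ U ∣ ≡ k) where

    ∣Z∣+2∣T∣≡k+k : ∣ Z ∣ + 2 * ∣ T ∣ ≡ k + k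
    ∣Z∣+2∣T∣≡k+k = trans ∣Z∣+2∣T∣≡2∣U∣ (trans (cong (2 *_) ∣U∣≡k) (cong (k +_) (+-identityʳ k)))

    triple⇒∣Z∣+2≤k+k : ∀ {e} → e ∈ T → ∣ Z ∣ + 2 ≤ k + k
    triple⇒∣Z∣+2≤k+k e∈T = begin
      ∣ Z ∣ + 2 * 1         ≤⟨ +-monoʳ-≤ ∣ Z ∣ (*-monoʳ-≤ 2 (x∈p⇒0<∣p∣ e∈T)) ⟩
      ∣ Z ∣ + 2 * ∣ T ∣     ≡⟨ ∣Z∣+2∣T∣≡k+k ⟩
      k + k                 ∎
      where open ≤-Reasoning

    girth>k⇒tripleFree : GirthGreater G k → ∀ {e} → e ∉ T
    girth>k⇒tripleFree girth {e} e∈T with triple⇒circuits e∈T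
    ... | inj₁ (ℓ , ℓ′ , C , C′ , ℓ+ℓ′≤∣Z∣) = <-irrefl refl (begin-strict
      k + k          <⟨ +-mono-< (girth ℓ C) (girth ℓ′ C′) ⟩
      ℓ + ℓ′         ≤⟨ ℓ+ℓ′≤∣Z∣ ⟩
      ∣ Z ∣          ≤⟨ m≤m+n ∣ Z ∣ 2 ⟩
      ∣ Z ∣ + 2      ≤⟨ triple⇒∣Z∣+2≤k+k e∈T ⟩
      k + k          ∎)
      where open ≤-Reasoning
    ... | inj₂ chorded = <-irrefl refl (begin-strict
      k + k                       <⟨ s≤s (n≤1+n (k + k)) ⟩
      suc (suc (k + k))           ≡⟨ cong suc (+-suc k k) ⟨
      suc k + suc k               ≤⟨ +-mono-≤ (girth _ (proj₁ chord-circuits)) (girth _ (proj₂ chord-circuits)) ⟩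
      suc q + suc (len ∸ q)       ≡⟨ chord-lengths ⟩
      suc (suc len)               ≡⟨ +-comm 2 len ⟩
      len + 2                     ≤⟨ +-monoˡ-≤ 2 len≤∣Z∣ ⟩
      ∣ Z ∣ + 2                   ≤⟨ triple⇒∣Z∣+2≤k+k e∈T ⟩
      k + k                       ∎)
      where
      open ≤-Reasoning
      open Chorded e∈T chorded

    girth≥k⇒core-bipartite : GirthAtLeast G k → IsBipartite G (edgesOf inCore)
    girth≥k⇒core-bipartite girth with nonempty? T
    ... | no none       = tripleFree⇒core-bipartite (λ e∈T → none (_ , e∈T))
    ... | yes (e , e∈T) with triple⇒circuits e∈T
    ...   | inj₁ (ℓ , ℓ′ , C , C′ , ℓ+ℓ′≤∣Z∣) = ⊥-elim (<-irrefl refl (begin-strict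
      k + k          ≤⟨ +-mono-≤ (girth ℓ C) (girth ℓ′ C′) ⟩
      ℓ + ℓ′         ≤⟨ ℓ+ℓ′≤∣Z∣ ⟩
      ∣ Z ∣          <⟨ m<m+n ∣ Z ∣ z<s ⟩
      ∣ Z ∣ + 2      ≤⟨ triple⇒∣Z∣+2≤k+k e∈T ⟩
      k + k          ∎))
      where open ≤-Reasoning
    ...   | inj₂ chorded = Tight.core-bipartite ∣T∣≤1 even
      where
      open Chorded e∈T chorded
      k+k≤len+2 : k + k ≤ len + 2
      k+k≤len+2 = begin
        k + k                   ≤⟨ +-mono-≤ (girth _ (proj₁ chord-circuits)) (girth _ (proj₂ chord-circuits)) ⟩
        suc q + suc (len ∸ q)   ≡⟨ chord-lengths ⟩
        suc (suc len)           ≡⟨ +-comm 2 len ⟩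
        len + 2                 ∎
        where open ≤-Reasoning
      len+2≤∣Z∣+2 : len + 2 ≤ ∣ Z ∣ + 2
      len+2≤∣Z∣+2 = +-monoˡ-≤ 2 len≤∣Z∣
      even : oddᵇ len ≡ false
      even = begin
        oddᵇ len                ≡⟨ oddᵇ-+2 len ⟨
        oddᵇ (suc (suc len))    ≡⟨ cong oddᵇ (+-comm 2 len) ⟩
        oddᵇ (len + 2)          ≡⟨ cong oddᵇ (≤-antisym (≤-trans len+2≤∣Z∣+2 (triple⇒∣Z∣+2≤k+k e∈T)) k+k≤len+2) ⟩
        oddᵇ (k + k)            ≡⟨ oddᵇ-double k ⟩
        false                   ∎
        where open ≡-Reasoning
      ∣T∣≤1 : ∣ T ∣ ≤ 1
      ∣T∣≤1 = *-cancelˡ-≤ 2 (+-cancelˡ-≤ ∣ Z ∣ _ _ (begin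
        ∣ Z ∣ + 2 * ∣ T ∣       ≡⟨ ∣Z∣+2∣T∣≡k+k ⟩
        k + k                   ≤⟨ k+k≤len+2 ⟩
        len + 2                 ≤⟨ len+2≤∣Z∣+2 ⟩
        ∣ Z ∣ + 2 * 1           ∎))
        where open ≤-Reasoning

  module _ {k : ℕ} (∣𝓤∣≡k : ∣ calU {G} M₁ M₂ M₃ ∣ ≡ k) where

    ∣U∣≡k : ∣ U ∣ ≡ k
    ∣U∣≡k = trans (cong ∣_∣ (sym calU≡U)) ∣𝓤∣≡k

    kCore-bipartite : GirthAtLeast G k → IsBipartite G (calM {G} M₁ M₂ M₃ ∪ calU {G} M₁ M₂ M₃)
    kCore-bipartite = subst (IsBipartite G) (sym core≡edgesOf-inCore) ∘ girth≥k⇒core-bipartite ∣U∣≡k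

    kCore-cyclic : GirthGreater G k → IsCyclic G (calM {G} M₁ M₂ M₃ ∪ calU {G} M₁ M₂ M₃)
    kCore-cyclic = subst (IsCyclic G) (sym core≡edgesOf-inCore) ∘ tripleFree⇒core-cyclic ∘ girth>k⇒tripleFree ∣U∣≡k

mainTheorem5 : (k : ℕ) (G : Graph) → Cubic G → Mu3 G k →
    (GirthAtLeast G k → ∀ H → IsKCore G k H → IsBipartite G H) ×
    (GirthGreater G k → ∀ H → IsKCore G k H → IsCyclic G H)
mainTheorem5 k G cubic _ = bipartite , cyclic
  where
  bipartite : GirthAtLeast G k → ∀ H → IsKCore G k H → IsBipartite G H
  bipartite girth H (M₁ , M₂ , M₃ , f₁ , f₂ , f₃ , _ , _ , _ , ∣𝓤∣≡k , refl) =
    Core.kCore-bipartite G cubic M₁ M₂ M₃ f₁ f₂ f₃ ∣𝓤∣≡k girth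
  cyclic : GirthGreater G k → ∀ H → IsKCore G k H → IsCyclic G H
  cyclic girth H (M₁ , M₂ , M₃ , f₁ , f₂ , f₃ , _ , _ , _ , ∣𝓤∣≡k , refl) =
    Core.kCore-cyclic G cubic M₁ M₂ M₃ f₁ f₂ f₃ ∣𝓤∣≡k girth
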